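{- Let $N\ge 1$ be an integer. For every integer $n\ge 1$, $$ CC_{N,n}=\Pi(n)\sum_{k=1}^{n}(-L_N)^k\sum_{\substack{i_1,\dots,i_k\ge 1\\ r^{N+i_1}+\cdots+r^{N+i_k}=n+k r^N}}\frac{(-1)^{i_1+\cdots+i_k}}{L_{N+i_1}\cdots L_{N+i_k}}\,. $$
   Context: Let $r$ be a power of a prime, $T$ an indeterminate and $K=\mathbb F_r(T)$. For $i\ge 1$ put $[i]=T^{r^i}-T$, $D_i=[i][i-1]^r\cdots[1]^{r^{i-1}}$ and $L_i=[i][i-1]\cdots[1]$, with $D_0=L_0=1$. The Carlitz logarithm is the formal power series $\log_C(x)=\sum_{i=0}^\infty(-1)^i x^{r^i}/L_i\in K[[x]]$. For a non-negative integer $i$ with base-$r$ expansion $i=\sum_{j=0}^m c_j r^j$ ($0\le c_j<r$), the Carlitz factorial is $\Pi(i)=\prod_{j=0}^m D_j^{c_j}$. For $N\ge 1$, the truncated Cauchy-Carlitz numbers $CC_{N,n}\in K$ are defined by the formal power series identity $$ \frac{(-1)^N x^{r^N}/L_N}{\log_C(x)-\sum_{i=0}^{N-1}(-1)^i x^{r^i}/L_i}=\sum_{n=0}^\infty\frac{CC_{N,n}}{\Pi(n)}x^n . $$ -}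

module Defs where

open import Level using (Level; _⊔_)
open import Algebra.Bundles using (CommutativeRing)
open import Data.Nat as ℕ using (ℕ; zero; suc; NonZero; _%_; _/_)
open import Data.Nat.Properties using (_≟_)
open import Data.Bool using (Bool; if_then_else_; _∧_)
open import Data.Vec using (Vec; []; _∷_; foldr)
import Data.Vec
open import Relation.Nullary using (¬_; does)
open import Relation.Nullary.Decidable using (⌊_⌋)

-- A field: a commutative ring with 1 ≠ 0 and an inverse operation that is a
-- two-sided inverse on every nonzero element (the value of 0⁻¹ is irrelevant).
record Field (c ℓ : Level) : Set (Level.suc (c ⊔ ℓ)) where
  field
    commutativeRing : CommutativeRing c ℓ
  open CommutativeRing commutativeRing public
  field
    _⁻¹      : Carrier → Carrier
    1≉0      : ¬ (1# ≈ 0#)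
    inverseʳ : ∀ x → ¬ (x ≈ 0#) → (x * (x ⁻¹)) ≈ 1#

module Carlitz {c ℓ : Level} (F : Field c ℓ) (r : ℕ) {{_ : NonZero r}} (T : Field.Carrier F) where
  open Field F

  pow : Carrier → ℕ → Carrier
  pow x zero    = 1#
  pow x (suc n) = x * pow x n

  natMul : ℕ → Carrier
  natMul zero    = 0#
  natMul (suc n) = 1# + natMul n

  sgn : ℕ → Carrier
  sgn i = pow (- 1#) i

  br : ℕ → Carrier
  br i = pow T (r ℕ.^ i) - T

  L : ℕ → Carrier
  L zero    = 1#
  L (suc i) = br (suc i) * L i

  -- D_0 = 1, D_i = [i] D_{i-1}^r  (= [i][i-1]^r ⋯ [1]^{r^{i-1}})
  D : ℕ → Carrier
  D zero    = 1#
  D (suc i) = br (suc i) * pow (D i) r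

  -- Π(n) = ∏_j D_j^{c_j} where n = Σ c_j r^j in base r.
  -- ΠAux fuel j n multiplies D_{j+t}^{(t-th base-r digit of n)} for t < fuel.
  ΠAux : ℕ → ℕ → ℕ → Carrier
  ΠAux zero    j n = 1#
  ΠAux (suc f) j n = pow (D j) (n % r) * ΠAux f (suc j) (n / r)

  -- fuel n+1 exceeds the number of base-r digits of n (further digits are 0)
  Π : ℕ → Carrier
  Π n = ΠAux (suc n) 0 n

  sumTo : ℕ → (ℕ → Carrier) → Carrier
  sumTo zero    f = 0#
  sumTo (suc n) f = f n + sumTo n f

  Series : Set c
  Series = ℕ → Carrier

  _⋆_ : Series → Series → Series
  (a ⋆ b) m = sumTo (suc m) (λ j → a j * b (m ℕ.∸ j))

  numer : ℕ → Series
  numer N m = if does (m ≟ r ℕ.^ N) then sgn N * (L N ⁻¹) else 0#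

  -- denominator log_C(x) - Σ_{i<N} (-1)^i x^{r^i}/L_i = Σ_{i≥N} (-1)^i x^{r^i}/L_i ;
  -- coefficient of x^m (only i ≤ m can have r^i = m, as r ≥ 2)
  denom : ℕ → Series
  denom N m = sumTo (suc m) (λ i →
    if (N ℕ.≤ᵇ i) ∧ does (r ℕ.^ i ≟ m) then sgn i * (L i ⁻¹) else 0#)

  -- c is the sequence of truncated Cauchy–Carlitz numbers CC_{N,·}:
  -- numer N = denom N · Σ_n (c n / Π(n)) x^n as formal power series
  IsCC : ℕ → (ℕ → Carrier) → Set ℓ
  IsCC N c = ∀ m → (denom N ⋆ (λ n → c n * (Π n ⁻¹))) m ≈ numer N m

  sumVec : (k B : ℕ) → (Vec ℕ k → Carrier) → Carrier
  sumVec zero    B f = f []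
  sumVec (suc k) B f = sumTo B (λ i → sumVec k B (λ v → f (suc i ∷ v)))

  sumℕ : ∀ {k} → Vec ℕ k → ℕ
  sumℕ = foldr _ ℕ._+_ 0

  mapℕ : ∀ {k} → (ℕ → ℕ) → Vec ℕ k → Vec ℕ k
  mapℕ = Data.Vec.map

  prodK : ∀ {k} → Vec ℕ k → (ℕ → Carrier) → Carrier
  prodK []      g = 1#
  prodK (i ∷ v) g = g i * prodK v g

  -- Any solution has every i_j ≤ n (r^{N+i}-r^N ≥ r^i - 1 ≥ i), so B = n loses nothing.
  inner : (N n k : ℕ) → Carrier
  inner N n k = sumVec k n (λ v →
    if does (sumℕ (mapℕ (λ i → r ℕ.^ (N ℕ.+ i)) v) ≟ n ℕ.+ k ℕ.* r ℕ.^ N)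
    then sgn (sumℕ v) * (prodK v (λ i → L (N ℕ.+ i)) ⁻¹)
    else 0#)

  rhs : (N n : ℕ) → Carrier
  rhs N n = Π n * sumTo n (λ k′ → pow (- L N) (suc k′) * inner N n (suc k′))

module Submission where

-- Dividing the defining identity by x^(r^N) turns it into a linear recurrence for
-- a n = CC_{N,n} / Π(n):  a 0 = 1 and, for n ≥ 1,
--   a n = Σ_{t ≥ 1} (-L_N) (-1)^t / L_{N+t} · a (n - (r^(N+t) - r^N)),
-- which has exactly one solution.  Unfolding it, the coefficient of (-L_N)^k in a n collects
-- the ordered k-tuples (i_1, …, i_k) with Σ_j (r^(N+i_j) - r^N) = n, each weighted by
-- (-1)^(i_1+⋯+i_k) / (L_{N+i_1} ⋯ L_{N+i_k}); this is the inner sum of the formula.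

open import Defs
open import Level using (Level)
open import Data.Nat using (ℕ; NonZero; _≤_; _^_)
open import Data.Nat.Primality using (Prime)
open import Data.Nat.Primality using (prime⇒nonTrivial; prime⇒nonZero)
open import Data.Product using (Σ; _×_)
open import Relation.Binary.PropositionalEquality using (_≡_)
open import Relation.Nullary using (¬_)

open import Data.Bool using (Bool; true; false; if_then_else_; _∧_)
open import Data.Empty using (⊥-elim)
open import Data.Nat as ℕ using (zero; suc; _<_; _≤?_; _≟_; _≤ᵇ_; _∸_; s≤s; z≤n)
import Data.Nat.Properties as ℕₚ
open import Data.Product using (_,_)
open import Data.Vec using (Vec; []; _∷_)
import Data.Vec as Vec
open import Data.Nat.Tactic.RingSolver using (solve-∀)
import Relation.Binary.PropositionalEquality as ≡
open import Relation.Nullary using (Dec; does; yes; no)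
open import Data.Nat.Induction using (<-rec)

module FieldProperties {c ℓ : Level} (F : Field c ℓ) where
  open Field F
  open import Algebra.Definitions _≈_ using (AlmostLeftCancellative)
  open import Algebra.Properties.CommutativeSemigroup *-commutativeSemigroup using (interchange)
  open import Algebra.Properties.AbelianGroup +-abelianGroup using (ε⁻¹≈ε; ⁻¹-involutive)
  open import Relation.Binary.Reasoning.Setoid setoid

  inverseˡ : ∀ x → ¬ x ≈ 0# → x ⁻¹ * x ≈ 1#
  inverseˡ x x≉0 = trans (*-comm _ _) (inverseʳ x x≉0)

  ⁻¹-cancelˡ : ∀ {x} y → ¬ x ≈ 0# → x ⁻¹ * (x * y) ≈ y
  ⁻¹-cancelˡ {x} y x≉0 = begin
    x ⁻¹ * (x * y)  ≈⟨ *-assoc _ _ _ ⟨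
    (x ⁻¹ * x) * y  ≈⟨ *-congʳ (inverseˡ x x≉0) ⟩
    1# * y          ≈⟨ *-identityˡ y ⟩
    y               ∎

  *-cancelˡ-nonzero : AlmostLeftCancellative 0# _*_
  *-cancelˡ-nonzero x y z x≉0 xy≈xz = begin
    y               ≈⟨ ⁻¹-cancelˡ y x≉0 ⟨
    x ⁻¹ * (x * y)  ≈⟨ *-congˡ xy≈xz ⟩
    x ⁻¹ * (x * z)  ≈⟨ ⁻¹-cancelˡ z x≉0 ⟩
    z               ∎

  *-cancelʳ-⁻¹ : ∀ x {y} → ¬ y ≈ 0# → (x * y) * y ⁻¹ ≈ x
  *-cancelʳ-⁻¹ x {y} y≉0 = trans (*-assoc _ _ _) (trans (*-congˡ (inverseʳ y y≉0)) (*-identityʳ x))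

  ⁻¹-cancelʳ : ∀ x {y} → ¬ y ≈ 0# → (x * y ⁻¹) * y ≈ x
  ⁻¹-cancelʳ x {y} y≉0 = trans (*-assoc _ _ _) (trans (*-congˡ (inverseˡ y y≉0)) (*-identityʳ x))

  *-nonzero : ∀ {x y} → ¬ x ≈ 0# → ¬ y ≈ 0# → ¬ x * y ≈ 0#
  *-nonzero {x} {y} x≉0 y≉0 xy≈0 = y≉0 (*-cancelˡ-nonzero x y 0# x≉0 (trans xy≈0 (sym (zeroʳ x))))

  ⁻¹-nonzero : ∀ {x} → ¬ x ≈ 0# → ¬ x ⁻¹ ≈ 0#
  ⁻¹-nonzero {x} x≉0 x⁻¹≈0 = 1≉0 (begin
    1#        ≈⟨ inverseʳ x x≉0 ⟨
    x * x ⁻¹  ≈⟨ *-congˡ x⁻¹≈0 ⟩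
    x * 0#    ≈⟨ zeroʳ x ⟩
    0#        ∎)

  ⁻¹-unique : ∀ {x y} → ¬ x ≈ 0# → x * y ≈ 1# → y ≈ x ⁻¹
  ⁻¹-unique {x} {y} x≉0 xy≈1 = *-cancelˡ-nonzero x y (x ⁻¹) x≉0 (trans xy≈1 (sym (inverseʳ x x≉0)))

  1⁻¹≈1 : 1# ⁻¹ ≈ 1#
  1⁻¹≈1 = sym (⁻¹-unique 1≉0 (*-identityˡ 1#))

  ⁻¹-distrib-* : ∀ {x y} → ¬ x ≈ 0# → ¬ y ≈ 0# → (x * y) ⁻¹ ≈ x ⁻¹ * y ⁻¹
  ⁻¹-distrib-* {x} {y} x≉0 y≉0 = sym (⁻¹-unique (*-nonzero x≉0 y≉0) (begin
    (x * y) * (x ⁻¹ * y ⁻¹)    ≈⟨ interchange x y _ _ ⟩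
    (x * x ⁻¹) * (y * y ⁻¹)    ≈⟨ *-cong (inverseʳ x x≉0) (inverseʳ y y≉0) ⟩
    1# * 1#                    ≈⟨ *-identityˡ 1# ⟩
    1#                         ∎))

  -1≉0 : ¬ - 1# ≈ 0#
  -1≉0 -1≈0 = 1≉0 (begin
    1#        ≈⟨ ⁻¹-involutive 1# ⟨
    - (- 1#)  ≈⟨ -‿cong -1≈0 ⟩
    - 0#      ≈⟨ ε⁻¹≈ε ⟩
    0#        ∎)

module SumProperties {c ℓ : Level} (F : Field c ℓ) (r : ℕ) {{_ : NonZero r}} (T : Field.Carrier F) where
  open Field F
  open Carlitz F r T
  open FieldProperties F
  open import Relation.Binary.Reasoning.Setoid setoid

  pow-nonzero : ∀ {x} n → ¬ x ≈ 0# → ¬ pow x n ≈ 0#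
  pow-nonzero zero    x≉0 = 1≉0
  pow-nonzero (suc n) x≉0 = *-nonzero x≉0 (pow-nonzero n x≉0)

  pow-+ : ∀ x m n → pow x (m ℕ.+ n) ≈ pow x m * pow x n
  pow-+ x zero    n = sym (*-identityˡ _)
  pow-+ x (suc m) n = trans (*-congˡ (pow-+ x m n)) (sym (*-assoc _ _ _))

  sumTo-cong : ∀ n {f g : ℕ → Carrier} → (∀ i → i < n → f i ≈ g i) → sumTo n f ≈ sumTo n g
  sumTo-cong zero    f≈g = refl
  sumTo-cong (suc n) f≈g = +-cong (f≈g n ℕₚ.≤-refl) (sumTo-cong n (λ i i<n → f≈g i (ℕₚ.m<n⇒m<1+n i<n)))

  sumTo-zero : ∀ n {f : ℕ → Carrier} → (∀ i → i < n → f i ≈ 0#) → sumTo n f ≈ 0#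
  sumTo-zero zero    f≈0 = refl
  sumTo-zero (suc n) f≈0 =
    trans (+-cong (f≈0 n ℕₚ.≤-refl) (sumTo-zero n (λ i i<n → f≈0 i (ℕₚ.m<n⇒m<1+n i<n)))) (+-identityˡ 0#)

  sumTo-distrib-+ : ∀ n (f g : ℕ → Carrier) → sumTo n (λ i → f i + g i) ≈ sumTo n f + sumTo n g
  sumTo-distrib-+ zero    f g = sym (+-identityˡ 0#)
  sumTo-distrib-+ (suc n) f g = begin
    (f n + g n) + sumTo n (λ i → f i + g i)  ≈⟨ +-congˡ (sumTo-distrib-+ n f g) ⟩
    (f n + g n) + (sumTo n f + sumTo n g)    ≈⟨ interchange (f n) (g n) _ _ ⟩
    (f n + sumTo n f) + (g n + sumTo n g)    ∎
    where open import Algebra.Properties.CommutativeSemigroup +-commutativeSemigroup using (interchange)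

  sumTo-*ˡ : ∀ n a (f : ℕ → Carrier) → a * sumTo n f ≈ sumTo n (λ i → a * f i)
  sumTo-*ˡ zero    a f = zeroʳ a
  sumTo-*ˡ (suc n) a f = trans (distribˡ a (f n) (sumTo n f)) (+-congˡ (sumTo-*ˡ n a f))

  sumTo-*ʳ : ∀ n a (f : ℕ → Carrier) → sumTo n f * a ≈ sumTo n (λ i → f i * a)
  sumTo-*ʳ n a f = trans (*-comm _ a) (trans (sumTo-*ˡ n a f) (sumTo-cong n (λ i _ → *-comm a (f i))))

  sumTo-swap : ∀ m n (f : ℕ → ℕ → Carrier) →
    sumTo m (λ i → sumTo n (f i)) ≈ sumTo n (λ j → sumTo m (λ i → f i j))
  sumTo-swap zero    n f = sym (sumTo-zero n (λ _ _ → refl))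
  sumTo-swap (suc m) n f =
    trans (+-congˡ (sumTo-swap m n f)) (sym (sumTo-distrib-+ n (f m) (λ j → sumTo m (λ i → f i j))))

  sumTo-split : ∀ m n (f : ℕ → Carrier) → sumTo (m ℕ.+ n) f ≈ sumTo m (λ i → f (n ℕ.+ i)) + sumTo n f
  sumTo-split zero    n f = sym (+-identityˡ _)
  sumTo-split (suc m) n f =
    trans (+-cong (reflexive (≡.cong f (ℕₚ.+-comm m n))) (sumTo-split m n f)) (sym (+-assoc _ _ _))

  sumTo-suc-first : ∀ n (f : ℕ → Carrier) → sumTo (suc n) f ≈ sumTo n (λ i → f (suc i)) + f 0
  sumTo-suc-first n f = begin
    sumTo (suc n) f                        ≡⟨ ≡.cong (λ m → sumTo m f) (ℕₚ.+-comm 1 n) ⟩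
    sumTo (n ℕ.+ 1) f                      ≈⟨ sumTo-split n 1 f ⟩
    sumTo n (λ i → f (suc i)) + (f 0 + 0#) ≈⟨ +-congˡ (+-identityʳ _) ⟩
    sumTo n (λ i → f (suc i)) + f 0        ∎

  sumTo-truncate : ∀ {m n} (f : ℕ → Carrier) → m ≤ n → (∀ i → m ≤ i → f i ≈ 0#) → sumTo n f ≈ sumTo m f
  sumTo-truncate {m} {n} f m≤n f≈0 = begin
    sumTo n f                                      ≡⟨ ≡.cong (λ k → sumTo k f) (ℕₚ.m∸n+n≡m m≤n) ⟨
    sumTo (n ∸ m ℕ.+ m) f                          ≈⟨ sumTo-split (n ∸ m) m f ⟩
    sumTo (n ∸ m) (λ i → f (m ℕ.+ i)) + sumTo m f  ≈⟨ +-congʳ (sumTo-zero (n ∸ m) (λ i _ → f≈0 _ (ℕₚ.m≤m+n m i))) ⟩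
    0# + sumTo m f                                 ≈⟨ +-identityˡ _ ⟩
    sumTo m f                                      ∎

  if-does-≈ : ∀ {p} {Q : Set p} (d : Dec Q) {x y z : Carrier} →
    (Q → x ≈ z) → (¬ Q → y ≈ z) → (if does d then x else y) ≈ z
  if-does-≈ (yes q) x≈z y≈z = x≈z q
  if-does-≈ (no ¬q) x≈z y≈z = y≈z ¬q

  ≈-if-does : ∀ {p} {Q : Set p} (d : Dec Q) {x y z : Carrier} →
    (Q → z ≈ x) → (¬ Q → z ≈ y) → z ≈ (if does d then x else y)
  ≈-if-does (yes q) z≈x z≈y = z≈x q
  ≈-if-does (no ¬q) z≈x z≈y = z≈y ¬q

  if-does-cong : ∀ {p q} {P : Set p} {Q : Set q} (d : Dec P) (e : Dec Q) {x y : Carrier} →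
    (P → Q) → (Q → P) → (P → x ≈ y) → (if does d then x else 0#) ≈ (if does e then y else 0#)
  if-does-cong (yes p) (yes q) P→Q Q→P x≈y = x≈y p
  if-does-cong (yes p) (no ¬q) P→Q Q→P x≈y = ⊥-elim (¬q (P→Q p))
  if-does-cong (no ¬p) (yes q) P→Q Q→P x≈y = ⊥-elim (¬p (Q→P q))
  if-does-cong (no ¬p) (no ¬q) P→Q Q→P x≈y = refl

  if-cong : ∀ (b : Bool) {x y} → x ≈ y → (if b then x else 0#) ≈ (if b then y else 0#)
  if-cong true  x≈y = x≈y
  if-cong false x≈y = refl

  if-∧-does-false : ∀ (b : Bool) {p} {Q : Set p} (d : Dec Q) {x} → ¬ Q → (if b ∧ does d then x else 0#) ≈ 0#
  if-∧-does-false true  d ¬q = if-does-≈ d (λ q → ⊥-elim (¬q q)) (λ _ → refl)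
  if-∧-does-false false d ¬q = refl

  if-*ʳ : ∀ (b : Bool) x y → (if b then x else 0#) * y ≈ (if b then x * y else 0#)
  if-*ʳ true  x y = refl
  if-*ʳ false x y = zeroˡ y

  if-*ˡ : ∀ (b : Bool) x y → x * (if b then y else 0#) ≈ (if b then x * y else 0#)
  if-*ˡ true  x y = refl
  if-*ˡ false x y = zeroʳ x

  if-+ : ∀ (b : Bool) x y → (if b then x else 0#) + (if b then y else 0#) ≈ (if b then x + y else 0#)
  if-+ true  x y = refl
  if-+ false x y = +-identityʳ 0#

  sumTo-if : ∀ (b : Bool) n (f : ℕ → Carrier) →
    sumTo n (λ i → if b then f i else 0#) ≈ (if b then sumTo n f else 0#)
  sumTo-if true  n f = refl
  sumTo-if false n f = sumTo-zero n (λ _ _ → refl)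

  sumTo-δ-outside : ∀ n k (g : ℕ → Carrier) → ¬ k < n → sumTo n (λ j → if does (k ≟ j) then g j else 0#) ≈ 0#
  sumTo-δ-outside n k g k≮n = sumTo-zero n (λ j j<n → if-does-≈ (k ≟ j) (λ { ≡.refl → ⊥-elim (k≮n j<n) }) (λ _ → refl))

  sumTo-δ : ∀ n k (g : ℕ → Carrier) → k < n → sumTo n (λ j → if does (k ≟ j) then g j else 0#) ≈ g k
  sumTo-δ (suc n) k g k<1+n with k ≟ n
  ... | yes ≡.refl = trans (+-cong (if-does-≈ (k ≟ k) (λ _ → refl) (λ k≢k → ⊥-elim (k≢k ≡.refl)))
                                    (sumTo-δ-outside n k g (ℕₚ.<-irrefl ≡.refl)))
                             (+-identityʳ _)
  ... | no  k≢n    = trans (+-cong (if-does-≈ (k ≟ n) (λ k≡n → ⊥-elim (k≢n k≡n)) (λ _ → refl))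
                                    (sumTo-δ n k g (ℕₚ.≤∧≢⇒< (ℕₚ.≤-pred k<1+n) k≢n)))
                             (+-identityˡ _)

  sumTo-guarded-δ : ∀ (b : Bool) m k (g : ℕ → Carrier) →
    sumTo (suc m) (λ j → if b ∧ does (k ≟ j) then g j else 0#) ≈
    (if b then (if does (k ≤? m) then g k else 0#) else 0#)
  sumTo-guarded-δ true  m k g = ≈-if-does (k ≤? m) (λ k≤m → sumTo-δ (suc m) k g (s≤s k≤m))
    (λ k≰m → sumTo-δ-outside (suc m) k g (λ k<1+m → k≰m (ℕₚ.≤-pred k<1+m)))
  sumTo-guarded-δ false m k g = sumTo-zero (suc m) (λ _ _ → refl)

  sumVec-cong : ∀ k B {f g : Vec ℕ k → Carrier} → (∀ v → f v ≈ g v) → sumVec k B f ≈ sumVec k B g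
  sumVec-cong zero    B f≈g = f≈g []
  sumVec-cong (suc k) B f≈g = sumTo-cong B (λ i _ → sumVec-cong k B (λ v → f≈g (suc i ∷ v)))

  sumVec-zero : ∀ k B {f : Vec ℕ k → Carrier} → (∀ v → f v ≈ 0#) → sumVec k B f ≈ 0#
  sumVec-zero zero    B f≈0 = f≈0 []
  sumVec-zero (suc k) B f≈0 = sumTo-zero B (λ i _ → sumVec-zero k B (λ v → f≈0 (suc i ∷ v)))

  sumVec-*ˡ : ∀ k B a (f : Vec ℕ k → Carrier) → a * sumVec k B f ≈ sumVec k B (λ v → a * f v)
  sumVec-*ˡ zero    B a f = refl
  sumVec-*ˡ (suc k) B a f = trans (sumTo-*ˡ B a _) (sumTo-cong B (λ i _ → sumVec-*ˡ k B a _))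

n<m^n : ∀ {m} → 1 < m → ∀ n → n < m ^ n
n<m^n 1<m zero = s≤s z≤n
n<m^n {m} 1<m (suc n) = begin-strict
  suc n        ≤⟨ n<m^n 1<m n ⟩
  m ^ n        <⟨ ℕₚ.m<m*n (m ^ n) m 1<m ⟩
  m ^ n ℕ.* m  ≡⟨ ℕₚ.*-comm (m ^ n) m ⟩
  m ^ suc n    ∎
  where
  open ℕₚ.≤-Reasoning
  instance
    m^n≢0 : NonZero (m ^ n)
    m^n≢0 = ℕₚ.m^n≢0 m n {{ℕ.>-nonZero (ℕₚ.<-trans (s≤s z≤n) 1<m)}}

1<prime^e : ∀ {p e} → Prime p → 1 ≤ e → 1 < p ^ e
1<prime^e {p} {e} p-prime 1≤e = ℕₚ.<-≤-trans 1<p (begin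
  p          ≡⟨ ℕₚ.^-identityʳ p ⟨
  p ^ 1      ≤⟨ ℕₚ.^-monoʳ-≤ p 1≤e ⟩
  p ^ e      ∎)
  where
  open ℕₚ.≤-Reasoning
  instance
    p-nonTrivial = prime⇒nonTrivial p-prime
    p≢0 = prime⇒nonZero p-prime
  1<p : 1 < p
  1<p = ℕ.nonTrivial⇒n>1 p

module Excess (r : ℕ) {{_ : NonZero r}} (1<r : 1 < r) (N : ℕ) where
  R : ℕ
  R = r ^ N

  excess : ℕ → ℕ
  excess j = r ^ (N ℕ.+ j) ∸ R

  r^[N+j]≡R+excess : ∀ j → r ^ (N ℕ.+ j) ≡ R ℕ.+ excess j
  r^[N+j]≡R+excess j = ≡.sym (ℕₚ.m+[n∸m]≡n (ℕₚ.^-monoʳ-≤ r (ℕₚ.m≤m+n N j)))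

  excess-zero : excess 0 ≡ 0
  excess-zero = ≡.trans (≡.cong (λ i → r ^ i ∸ R) (ℕₚ.+-identityʳ N)) (ℕₚ.n∸n≡0 R)

  j≤excess : ∀ j → j ≤ excess j
  j≤excess j = ℕₚ.+-cancelˡ-≤ R j (excess j) (begin
    R ℕ.+ j            ≤⟨ ℕₚ.+-monoʳ-≤ R (ℕₚ.m≤n*m j R) ⟩
    R ℕ.+ R ℕ.* j      ≡⟨ ℕₚ.*-suc R j ⟨
    R ℕ.* suc j        ≤⟨ ℕₚ.*-monoʳ-≤ R (n<m^n 1<r j) ⟩
    R ℕ.* r ^ j        ≡⟨ ℕₚ.^-distribˡ-+-* r N j ⟨
    r ^ (N ℕ.+ j)      ≡⟨ r^[N+j]≡R+excess j ⟩
    R ℕ.+ excess j     ∎)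
    where
    open ℕₚ.≤-Reasoning
    instance
      R≢0 : NonZero R
      R≢0 = ℕₚ.m^n≢0 r N

  n<excess : ∀ {n} t → n ≤ t → n < excess (suc t)
  n<excess t n≤t = ℕₚ.<-≤-trans (s≤s n≤t) (j≤excess (suc t))

  sum-r^[N+i] : ∀ {k} (v : Vec ℕ k) → Vec.sum (Vec.map (λ i → r ^ (N ℕ.+ i)) v) ≡ Vec.sum (Vec.map excess v) ℕ.+ k ℕ.* R
  sum-r^[N+i] []              = ≡.refl
  sum-r^[N+i] {suc k} (i ∷ v) = ≡.trans (≡.cong₂ ℕ._+_ (r^[N+j]≡R+excess i) (sum-r^[N+i] v))
                                        (regroup R (excess i) (Vec.sum (Vec.map excess v)) (k ℕ.* R))
    where
    regroup : ∀ x a b c → (x ℕ.+ a) ℕ.+ (b ℕ.+ c) ≡ (a ℕ.+ b) ℕ.+ (x ℕ.+ c)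
    regroup = solve-∀

  ∸excess< : ∀ {n} t → excess (suc t) ≤ n → n ∸ excess (suc t) < n
  ∸excess< t e≤n = ℕₚ.∸-monoʳ-< {o = 0} (ℕₚ.<-≤-trans (s≤s z≤n) (j≤excess (suc t))) e≤n

module CauchyCarlitz {c ℓ : Level} (F : Field c ℓ) (r : ℕ) {{_ : NonZero r}} (T : Field.Carrier F)
  (1<r : 1 < r) (br≉0 : ∀ i → 1 ≤ i → ¬ Field._≈_ F (Carlitz.br F r T i) (Field.0# F)) (N : ℕ) where
  open Field F
  open Carlitz F r T
  open FieldProperties F
  open SumProperties F r T
  open Excess r 1<r N
  open import Algebra.Properties.Ring ring using (-‿distribʳ-*)
  open import Algebra.Properties.AbelianGroup +-abelianGroup using () renaming (∙-cancelʳ to +-cancelʳ)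
  open import Relation.Binary.Reasoning.Setoid setoid

  L-nonzero : ∀ i → ¬ L i ≈ 0#
  L-nonzero zero    = 1≉0
  L-nonzero (suc i) = *-nonzero (br≉0 (suc i) (s≤s z≤n)) (L-nonzero i)

  D-nonzero : ∀ i → ¬ D i ≈ 0#
  D-nonzero zero    = 1≉0
  D-nonzero (suc i) = *-nonzero (br≉0 (suc i) (s≤s z≤n)) (pow-nonzero r (D-nonzero i))

  ΠAux-nonzero : ∀ f j n → ¬ ΠAux f j n ≈ 0#
  ΠAux-nonzero zero    j n = 1≉0
  ΠAux-nonzero (suc f) j n = *-nonzero (pow-nonzero (n ℕ.% r) (D-nonzero j)) (ΠAux-nonzero f (suc j) (n ℕ./ r))

  Π-nonzero : ∀ n → ¬ Π n ≈ 0#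
  Π-nonzero n = ΠAux-nonzero (suc n) 0 n

  sgn-nonzero : ∀ i → ¬ sgn i ≈ 0#
  sgn-nonzero i = pow-nonzero i -1≉0

  logCoeff : ℕ → Carrier
  logCoeff i = sgn i * L i ⁻¹

  logCoeff-nonzero : ∀ i → ¬ logCoeff i ≈ 0#
  logCoeff-nonzero i = *-nonzero (sgn-nonzero i) (⁻¹-nonzero (L-nonzero i))

  -- Every t with excess (suc t) ≤ n satisfies t < n, so the range of t is complete.
  shiftSum : (ℕ → Carrier) → (ℕ → Carrier) → ℕ → Carrier
  shiftSum a X n = sumTo n (λ t → if does (excess (suc t) ≤? n) then a t * X (n ∸ excess (suc t)) else 0#)

  shiftSum-congʳ : ∀ a n {X Y : ℕ → Carrier} → (∀ m → m < n → X m ≈ Y m) → shiftSum a X n ≈ shiftSum a Y n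
  shiftSum-congʳ a n X≈Y = sumTo-cong n (λ t _ → let d = excess (suc t) ≤? n in
    if-does-cong d d (λ e≤n → e≤n) (λ e≤n → e≤n) (λ e≤n → *-congˡ (X≈Y _ (∸excess< t e≤n))))

  shiftSum-zeroˡ : ∀ {a} n X → (∀ t → a t ≈ 0#) → shiftSum a X n ≈ 0#
  shiftSum-zeroˡ n X a≈0 = sumTo-zero n (λ t _ →
    if-does-≈ (excess (suc t) ≤? n) (λ _ → trans (*-congʳ (a≈0 t)) (zeroˡ _)) (λ _ → refl))

  shiftSum-zeroʳ : ∀ a n {X} → (∀ m → m < n → X m ≈ 0#) → shiftSum a X n ≈ 0#
  shiftSum-zeroʳ a n X≈0 = trans (shiftSum-congʳ a n X≈0) (sumTo-zero n (λ t _ →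
    if-does-≈ (excess (suc t) ≤? n) (λ _ → zeroʳ (a t)) (λ _ → refl)))

  shiftSum-distrib-+ : ∀ a b X n → shiftSum a X n + shiftSum b X n ≈ shiftSum (λ t → a t + b t) X n
  shiftSum-distrib-+ a b X n = trans (sym (sumTo-distrib-+ n _ _)) (sumTo-cong n (λ t _ →
    let cond = does (excess (suc t) ≤? n) in
    trans (if-+ cond _ _) (if-cong cond (sym (distribʳ _ (a t) (b t))))))

  shiftSum-*-coeff : ∀ x a X n → x * shiftSum a X n ≈ shiftSum (λ t → x * a t) X n
  shiftSum-*-coeff x a X n = trans (sumTo-*ˡ n x _) (sumTo-cong n (λ t _ →
    let cond = does (excess (suc t) ≤? n) in
    trans (if-*ˡ cond x _) (if-cong cond (sym (*-assoc x (a t) _)))))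

  shiftSum-*-seq : ∀ x a X n → x * shiftSum a X n ≈ shiftSum a (λ m → x * X m) n
  shiftSum-*-seq x a X n = trans (sumTo-*ˡ n x _) (sumTo-cong n (λ t _ →
    let cond = does (excess (suc t) ≤? n) in
    trans (if-*ˡ cond x _) (if-cong cond (x∙yz≈y∙xz x (a t) _))))
    where open import Algebra.Properties.CommutativeSemigroup *-commutativeSemigroup using (x∙yz≈y∙xz)

  sumTo-shiftSum : ∀ K a (Y : ℕ → ℕ → Carrier) n →
    sumTo K (λ k → shiftSum a (Y k) n) ≈ shiftSum a (λ m → sumTo K (λ k → Y k m)) n
  sumTo-shiftSum K a Y n = trans (sumTo-swap K n _) (sumTo-cong n (λ t _ →
    let cond = does (excess (suc t) ≤? n) in
    trans (sumTo-if cond K _) (if-cong cond (sym (sumTo-*ˡ K (a t) _)))))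

  denomTerm : (ℕ → Carrier) → ℕ → ℕ → Carrier
  denomTerm X m i = if N ≤ᵇ i then (if does (r ^ i ≤? m) then logCoeff i * X (m ∸ r ^ i) else 0#) else 0#

  denom-⋆ : ∀ X m → (denom N ⋆ X) m ≈ sumTo (suc m) (denomTerm X m)
  denom-⋆ X m = begin
    (denom N ⋆ X) m                                       ≈⟨ sumTo-cong (suc m) expand ⟩
    sumTo (suc m) (λ j → sumTo (suc m) (λ i → term i j))  ≈⟨ sumTo-swap (suc m) (suc m) (λ j i → term i j) ⟩
    sumTo (suc m) (λ i → sumTo (suc m) (term i))          ≈⟨ sumTo-cong (suc m) (λ i _ →
                                                               sumTo-guarded-δ (N ≤ᵇ i) m (r ^ i) (λ j → logCoeff i * X (m ∸ j))) ⟩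
    sumTo (suc m) (denomTerm X m)                         ∎
    where
    term : ℕ → ℕ → Carrier
    term i j = if (N ≤ᵇ i) ∧ does (r ^ i ≟ j) then logCoeff i * X (m ∸ j) else 0#

    term-vanish : ∀ {i j} → j < i → term i j ≈ 0#
    term-vanish {i} {j} j<i = if-∧-does-false (N ≤ᵇ i) (r ^ i ≟ j)
      (λ r^i≡j → ℕₚ.<-irrefl (≡.sym r^i≡j) (ℕₚ.<-trans j<i (n<m^n 1<r i)))

    expand : ∀ j → j < suc m → denom N j * X (m ∸ j) ≈ sumTo (suc m) (λ i → term i j)
    expand j j<1+m = begin
      denom N j * X (m ∸ j)
        ≈⟨ sumTo-*ʳ (suc j) _ _ ⟩
      sumTo (suc j) (λ i → (if (N ≤ᵇ i) ∧ does (r ^ i ≟ j) then logCoeff i else 0#) * X (m ∸ j))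
        ≈⟨ sumTo-cong (suc j) (λ i _ → if-*ʳ ((N ≤ᵇ i) ∧ does (r ^ i ≟ j)) _ _) ⟩
      sumTo (suc j) (λ i → term i j)
        ≈⟨ sumTo-truncate (λ i → term i j) j<1+m (λ i j<i → term-vanish j<i) ⟨
      sumTo (suc m) (λ i → term i j) ∎

  denom-⋆-below : ∀ X {m} → m < R → (denom N ⋆ X) m ≈ 0#
  denom-⋆-below X {m} m<R = trans (denom-⋆ X m) (sumTo-zero (suc m) (λ i _ →
    if-does-≈ (N ≤? i)
      (λ N≤i → if-does-≈ (r ^ i ≤? m)
        (λ r^i≤m → ⊥-elim (ℕₚ.<⇒≱ m<R (ℕₚ.≤-trans (ℕₚ.^-monoʳ-≤ r N≤i) r^i≤m)))
        (λ _ → refl))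
      (λ _ → refl)))

  denomTerm-above : ∀ X n j → denomTerm X (R ℕ.+ n) (N ℕ.+ j) ≈
    (if does (excess j ≤? n) then logCoeff (N ℕ.+ j) * X (n ∸ excess j) else 0#)
  denomTerm-above X n j = if-does-≈ (N ≤? N ℕ.+ j)
    (λ _ → if-does-cong (r ^ (N ℕ.+ j) ≤? R ℕ.+ n) (excess j ≤? n)
      (λ le → ℕₚ.+-cancelˡ-≤ R _ _ (≡.subst (_≤ R ℕ.+ n) (r^[N+j]≡R+excess j) le))
      (λ le → ≡.subst (_≤ R ℕ.+ n) (≡.sym (r^[N+j]≡R+excess j)) (ℕₚ.+-monoʳ-≤ R le))
      (λ _ → *-congˡ (reflexive (≡.cong X gap))))
    (λ N≰N+j → ⊥-elim (N≰N+j (ℕₚ.m≤m+n N j)))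
    where
    gap : R ℕ.+ n ∸ r ^ (N ℕ.+ j) ≡ n ∸ excess j
    gap = ≡.trans (≡.cong (R ℕ.+ n ∸_) (r^[N+j]≡R+excess j)) (ℕₚ.[m+n]∸[m+o]≡n∸o R n (excess j))

  denom-⋆-above : ∀ X n →
    (denom N ⋆ X) (R ℕ.+ n) ≈ logCoeff N * X n + shiftSum (λ t → logCoeff (N ℕ.+ suc t)) X n
  denom-⋆-above X n = begin
    (denom N ⋆ X) m                                    ≈⟨ denom-⋆ X m ⟩
    sumTo (suc m) f                                    ≡⟨ ≡.cong (λ k → sumTo k f) length ⟨
    sumTo (suc m′ ℕ.+ N) f                             ≈⟨ sumTo-split (suc m′) N f ⟩
    sumTo (suc m′) (λ j → f (N ℕ.+ j)) + sumTo N f     ≈⟨ +-cong (sumTo-suc-first m′ _) (sumTo-zero N below-N) ⟩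
    (sumTo m′ (λ t → f (N ℕ.+ suc t)) + f (N ℕ.+ 0)) + 0#
                                                       ≈⟨ trans (+-identityʳ _) (+-comm _ _) ⟩
    f (N ℕ.+ 0) + sumTo m′ (λ t → f (N ℕ.+ suc t))     ≈⟨ +-cong leading (sumTo-truncate _ n≤m′ beyond) ⟩
    logCoeff N * X n + sumTo n (λ t → f (N ℕ.+ suc t)) ≈⟨ +-congˡ (sumTo-cong n (λ t _ → denomTerm-above X n (suc t))) ⟩
    logCoeff N * X n + shiftSum (λ t → logCoeff (N ℕ.+ suc t)) X n ∎
    where
    m = R ℕ.+ n
    m′ = m ∸ N
    f = denomTerm X m

    N≤R : N ≤ R
    N≤R = ℕₚ.<⇒≤ (n<m^n 1<r N)

    length : suc m′ ℕ.+ N ≡ suc m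
    length = ≡.cong suc (ℕₚ.m∸n+n≡m (ℕₚ.≤-trans N≤R (ℕₚ.m≤m+n R n)))

    n≤m′ : n ≤ m′
    n≤m′ = ≡.subst (_≤ m′) (ℕₚ.m+n∸m≡n R n) (ℕₚ.∸-monoʳ-≤ m N≤R)

    below-N : ∀ i → i < N → f i ≈ 0#
    below-N i i<N = if-does-≈ (N ≤? i) (λ N≤i → ⊥-elim (ℕₚ.<⇒≱ i<N N≤i)) (λ _ → refl)

    leading : f (N ℕ.+ 0) ≈ logCoeff N * X n
    leading = trans (denomTerm-above X n 0) (if-does-≈ (excess 0 ≤? n)
      (λ _ → *-cong (reflexive (≡.cong logCoeff (ℕₚ.+-identityʳ N))) (reflexive (≡.cong (λ k → X (n ∸ k)) excess-zero)))
      (λ e≰n → ⊥-elim (e≰n (≡.subst (_≤ n) (≡.sym excess-zero) z≤n))))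

    beyond : ∀ t → n ≤ t → f (N ℕ.+ suc t) ≈ 0#
    beyond t n≤t = trans (denomTerm-above X n (suc t))
      (if-does-≈ (excess (suc t) ≤? n) (λ e≤n → ⊥-elim (ℕₚ.<⇒≱ (n<excess t n≤t) e≤n)) (λ _ → refl))

  Recurrent : (ℕ → Carrier) → Set ℓ
  Recurrent X = ∀ n → logCoeff N * X n + shiftSum (λ t → logCoeff (N ℕ.+ suc t)) X n
                      ≈ (if does (n ≟ 0) then logCoeff N else 0#)

  Recurrent-cong : ∀ {X Y} → (∀ n → X n ≈ Y n) → Recurrent X → Recurrent Y
  Recurrent-cong X≈Y recX n =
    trans (sym (+-cong (*-congˡ (X≈Y n)) (shiftSum-congʳ _ n (λ m _ → X≈Y m)))) (recX n)

  Recurrent-unique : ∀ {X Y} → Recurrent X → Recurrent Y → ∀ n → X n ≈ Y n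
  Recurrent-unique {X} {Y} recX recY = <-rec (λ n → X n ≈ Y n) step
    where
    step : ∀ n → (∀ {m} → m < n → X m ≈ Y m) → X n ≈ Y n
    step n ih = *-cancelˡ-nonzero (logCoeff N) (X n) (Y n) (logCoeff-nonzero N)
      (+-cancelʳ _ _ _ (trans (recX n)
        (sym (trans (+-congˡ (shiftSum-congʳ _ n (λ m m<n → ih m<n))) (recY n)))))

  numer-below : ∀ {m} → m < R → numer N m ≈ 0#
  numer-below {m} m<R = if-does-≈ (m ≟ R) (λ m≡R → ⊥-elim (ℕₚ.<-irrefl m≡R m<R)) (λ _ → refl)

  numer-above : ∀ n → numer N (R ℕ.+ n) ≈ (if does (n ≟ 0) then logCoeff N else 0#)
  numer-above n = if-does-cong (R ℕ.+ n ≟ R) (n ≟ 0)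
    (λ R+n≡R → ℕₚ.+-cancelˡ-≡ R n 0 (≡.trans R+n≡R (≡.sym (ℕₚ.+-identityʳ R))))
    (λ { ≡.refl → ℕₚ.+-identityʳ R })
    (λ _ → refl)

  _/Π : (ℕ → Carrier) → ℕ → Carrier
  (cc /Π) n = cc n * Π n ⁻¹

  IsCC⇒Recurrent : ∀ cc → IsCC N cc → Recurrent (cc /Π)
  IsCC⇒Recurrent cc isCC n =
    trans (sym (denom-⋆-above (cc /Π) n)) (trans (isCC (R ℕ.+ n)) (numer-above n))

  Recurrent⇒IsCC : ∀ cc → Recurrent (cc /Π) → IsCC N cc
  Recurrent⇒IsCC cc rec m with m ℕ.<? R
  ... | yes m<R = trans (denom-⋆-below (cc /Π) m<R) (sym (numer-below m<R))
  ... | no  m≮R = ≡.subst (λ k → (denom N ⋆ (cc /Π)) k ≈ numer N k) (ℕₚ.m+[n∸m]≡n (ℕₚ.≮⇒≥ m≮R))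
                    (trans (denom-⋆-above (cc /Π) (m ∸ R)) (trans (rec (m ∸ R)) (sym (numer-above (m ∸ R)))))

  weight : ℕ → Carrier
  weight t = sgn (suc t) * L (N ℕ.+ suc t) ⁻¹

  tupleSum : ℕ → ℕ → Carrier
  tupleSum n zero    = if does (0 ≟ n) then 1# else 0#
  tupleSum n (suc k) = shiftSum weight (λ m → tupleSum m k) n

  solution : ℕ → Carrier
  solution n = sumTo (suc n) (λ k → pow (- L N) k * tupleSum n k)

  tupleSum-vanish : ∀ k m → m < k → tupleSum m k ≈ 0#
  tupleSum-vanish (suc k) m (s≤s m≤k) =
    shiftSum-zeroʳ weight m (λ m′ m′<m → tupleSum-vanish k m′ (ℕₚ.<-≤-trans m′<m m≤k))

  solution-suc : ∀ n → solution (suc n) ≈ sumTo (suc n) (λ k → pow (- L N) (suc k) * tupleSum (suc n) (suc k))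
  solution-suc n = trans (sumTo-suc-first (suc n) _) (trans (+-congˡ (zeroʳ _)) (+-identityʳ _))

  solution-step : ∀ n → solution (suc n) ≈ shiftSum (λ t → - L N * weight t) solution (suc n)
  solution-step n = begin
    solution (suc n)
      ≈⟨ solution-suc n ⟩
    sumTo (suc n) (λ k → pow (- L N) (suc k) * tupleSum (suc n) (suc k))
      ≈⟨ sumTo-cong (suc n) (λ k _ → scale k) ⟩
    sumTo (suc n) (λ k → shiftSum μ (λ m → pow (- L N) k * tupleSum m k) (suc n))
      ≈⟨ sumTo-shiftSum (suc n) μ (λ k m → pow (- L N) k * tupleSum m k) (suc n) ⟩
    shiftSum μ (λ m → sumTo (suc n) (λ k → pow (- L N) k * tupleSum m k)) (suc n)
      ≈⟨ shiftSum-congʳ μ (suc n) (λ m m<1+n → sumTo-truncate (λ k → pow (- L N) k * tupleSum m k) m<1+n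
           (λ k m<k → trans (*-congˡ (tupleSum-vanish k m m<k)) (zeroʳ _))) ⟩
    shiftSum μ solution (suc n) ∎
    where
    μ : ℕ → Carrier
    μ t = - L N * weight t

    scale : ∀ k → pow (- L N) (suc k) * tupleSum (suc n) (suc k) ≈
                  shiftSum μ (λ m → pow (- L N) k * tupleSum m k) (suc n)
    scale k = begin
      (- L N * pow (- L N) k) * shiftSum weight (λ m → tupleSum m k) (suc n)
        ≈⟨ *-assoc _ _ _ ⟩
      - L N * (pow (- L N) k * shiftSum weight (λ m → tupleSum m k) (suc n))
        ≈⟨ *-congˡ (shiftSum-*-seq (pow (- L N) k) weight (λ m → tupleSum m k) (suc n)) ⟩
      - L N * shiftSum weight (λ m → pow (- L N) k * tupleSum m k) (suc n)
        ≈⟨ shiftSum-*-coeff (- L N) weight (λ m → pow (- L N) k * tupleSum m k) (suc n) ⟩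
      shiftSum μ (λ m → pow (- L N) k * tupleSum m k) (suc n) ∎

  logCoeff-N*-L : logCoeff N * - L N ≈ - sgn N
  logCoeff-N*-L = begin
    (sgn N * L N ⁻¹) * - L N    ≈⟨ -‿distribʳ-* _ _ ⟨
    - ((sgn N * L N ⁻¹) * L N)  ≈⟨ -‿cong (⁻¹-cancelʳ (sgn N) (L-nonzero N)) ⟩
    - sgn N                     ∎

  logCoeff-N+suc : ∀ t → logCoeff (N ℕ.+ suc t) ≈ sgn N * weight t
  logCoeff-N+suc t = trans (*-congʳ (pow-+ (- 1#) N (suc t))) (*-assoc _ _ _)

  recurrence-coefficients-cancel : ∀ t → logCoeff N * (- L N * weight t) + logCoeff (N ℕ.+ suc t) ≈ 0#
  recurrence-coefficients-cancel t = begin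
    logCoeff N * (- L N * weight t) + logCoeff (N ℕ.+ suc t)  ≈⟨ +-cong (sym (*-assoc _ _ _)) (logCoeff-N+suc t) ⟩
    (logCoeff N * - L N) * weight t + sgn N * weight t        ≈⟨ +-congʳ (*-congʳ logCoeff-N*-L) ⟩
    - sgn N * weight t + sgn N * weight t                     ≈⟨ distribʳ _ _ _ ⟨
    (- sgn N + sgn N) * weight t                              ≈⟨ *-congʳ (-‿inverseˡ _) ⟩
    0# * weight t                                             ≈⟨ zeroˡ _ ⟩
    0#                                                        ∎

  solution-recurrent : Recurrent solution
  solution-recurrent zero =
    trans (+-identityʳ _) (trans (*-congˡ (trans (+-identityʳ _) (*-identityˡ 1#))) (*-identityʳ _))
  solution-recurrent (suc n) = begin
    logCoeff N * solution (suc n) + shiftSum β solution (suc n)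
      ≈⟨ +-congʳ (*-congˡ (solution-step n)) ⟩
    logCoeff N * shiftSum (λ t → - L N * weight t) solution (suc n) + shiftSum β solution (suc n)
      ≈⟨ +-congʳ (shiftSum-*-coeff _ _ solution (suc n)) ⟩
    shiftSum (λ t → logCoeff N * (- L N * weight t)) solution (suc n) + shiftSum β solution (suc n)
      ≈⟨ shiftSum-distrib-+ _ β solution (suc n) ⟩
    shiftSum (λ t → logCoeff N * (- L N * weight t) + β t) solution (suc n)
      ≈⟨ shiftSum-zeroˡ (suc n) solution recurrence-coefficients-cancel ⟩
    0# ∎
    where
    β : ℕ → Carrier
    β t = logCoeff (N ℕ.+ suc t)

  tupleWeight : ∀ {k} → Vec ℕ k → Carrier
  tupleWeight v = sgn (sumℕ v) * prodK v (λ i → L (N ℕ.+ i)) ⁻¹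

  prodK-nonzero : ∀ {k} (v : Vec ℕ k) → ¬ prodK v (λ i → L (N ℕ.+ i)) ≈ 0#
  prodK-nonzero []      = 1≉0
  prodK-nonzero (i ∷ v) = *-nonzero (L-nonzero (N ℕ.+ i)) (prodK-nonzero v)

  tupleWeight-∷ : ∀ t {k} (v : Vec ℕ k) → tupleWeight (suc t ∷ v) ≈ weight t * tupleWeight v
  tupleWeight-∷ t v = trans
    (*-cong (pow-+ (- 1#) (suc t) (sumℕ v)) (⁻¹-distrib-* (L-nonzero (N ℕ.+ suc t)) (prodK-nonzero v)))
    (interchange _ _ _ _)
    where open import Algebra.Properties.CommutativeSemigroup *-commutativeSemigroup using (interchange)

  boundedTupleSum : (B n k : ℕ) → Carrier
  boundedTupleSum B n k = sumVec k B (λ v → if does (sumℕ (mapℕ excess v) ≟ n) then tupleWeight v else 0#)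

  inner≈boundedTupleSum : ∀ n k → inner N n k ≈ boundedTupleSum n n k
  inner≈boundedTupleSum n k = sumVec-cong k n (λ v →
    if-does-cong (sumℕ (mapℕ (λ i → r ^ (N ℕ.+ i)) v) ≟ n ℕ.+ k ℕ.* R) (sumℕ (mapℕ excess v) ≟ n)
      (λ eq → ℕₚ.+-cancelʳ-≡ _ _ _ (≡.trans (≡.sym (sum-r^[N+i] v)) eq))
      (λ eq → ≡.trans (sum-r^[N+i] v) (≡.cong (ℕ._+ k ℕ.* R) eq))
      (λ _ → refl))

  boundedTupleSum-suc : ∀ B n k → boundedTupleSum B n (suc k) ≈
    sumTo B (λ t → if does (excess (suc t) ≤? n) then weight t * boundedTupleSum B (n ∸ excess (suc t)) k else 0#)
  boundedTupleSum-suc B n k = sumTo-cong B (λ t _ → ≈-if-does (excess (suc t) ≤? n) (fits t) (overshoots t))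
    where
    σ : ∀ {k} → Vec ℕ k → ℕ
    σ v = sumℕ (mapℕ excess v)

    fits : ∀ t → excess (suc t) ≤ n →
      sumVec k B (λ v → if does (excess (suc t) ℕ.+ σ v ≟ n) then tupleWeight (suc t ∷ v) else 0#)
      ≈ weight t * boundedTupleSum B (n ∸ excess (suc t)) k
    fits t e≤n = trans
      (sumVec-cong k B (λ v → trans
        (if-does-cong (excess (suc t) ℕ.+ σ v ≟ n) (σ v ≟ n ∸ excess (suc t))
          (λ eq → ≡.trans (≡.sym (ℕₚ.m+n∸m≡n (excess (suc t)) (σ v))) (≡.cong (_∸ excess (suc t)) eq))
          (λ eq → ≡.trans (≡.cong (excess (suc t) ℕ.+_) eq) (ℕₚ.m+[n∸m]≡n e≤n))
          (λ _ → tupleWeight-∷ t v))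
        (sym (if-*ˡ (does (σ v ≟ n ∸ excess (suc t))) (weight t) _))))
      (sym (sumVec-*ˡ k B (weight t) _))

    overshoots : ∀ t → ¬ excess (suc t) ≤ n →
      sumVec k B (λ v → if does (excess (suc t) ℕ.+ σ v ≟ n) then tupleWeight (suc t ∷ v) else 0#) ≈ 0#
    overshoots t e≰n = sumVec-zero k B (λ v → if-does-≈ (excess (suc t) ℕ.+ σ v ≟ n)
      (λ eq → ⊥-elim (e≰n (ℕₚ.≤-trans (ℕₚ.m≤m+n _ _) (ℕₚ.≤-reflexive eq))))
      (λ _ → refl))

  boundedTupleSum≈tupleSum : ∀ k {B n} → n ≤ B → boundedTupleSum B n k ≈ tupleSum n k
  boundedTupleSum≈tupleSum zero    {n = n} _ = if-cong (does (0 ≟ n)) (trans (*-identityˡ _) 1⁻¹≈1)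
  boundedTupleSum≈tupleSum (suc k) {B} {n} n≤B = begin
    boundedTupleSum B n (suc k)                      ≈⟨ boundedTupleSum-suc B n k ⟩
    sumTo B (λ t → if does (excess (suc t) ≤? n) then weight t * boundedTupleSum B (n ∸ excess (suc t)) k else 0#)
                                                     ≈⟨ sumTo-truncate _ n≤B beyond ⟩
    shiftSum weight (λ m → boundedTupleSum B m k) n  ≈⟨ shiftSum-congʳ weight n (λ m m<n →
                                                          boundedTupleSum≈tupleSum k (ℕₚ.≤-trans (ℕₚ.<⇒≤ m<n) n≤B)) ⟩
    tupleSum n (suc k)                               ∎
    where
    beyond : ∀ t → n ≤ t →
      (if does (excess (suc t) ≤? n) then weight t * boundedTupleSum B (n ∸ excess (suc t)) k else 0#) ≈ 0#
    beyond t n≤t = if-does-≈ (excess (suc t) ≤? n) (λ e≤n → ⊥-elim (ℕₚ.<⇒≱ (n<excess t n≤t) e≤n)) (λ _ → refl)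

  inner≈tupleSum : ∀ n k → inner N n k ≈ tupleSum n k
  inner≈tupleSum n k = trans (inner≈boundedTupleSum n k) (boundedTupleSum≈tupleSum k ℕₚ.≤-refl)

  solution-formula : ∀ n → solution (suc n) ≈ sumTo (suc n) (λ k → pow (- L N) (suc k) * inner N (suc n) (suc k))
  solution-formula n =
    trans (solution-suc n) (sumTo-cong (suc n) (λ k _ → *-congˡ (sym (inner≈tupleSum (suc n) (suc k)))))

  cauchyCarlitz : ℕ → Carrier
  cauchyCarlitz n = solution n * Π n

  cauchyCarlitz-isCC : IsCC N cauchyCarlitz
  cauchyCarlitz-isCC = Recurrent⇒IsCC cauchyCarlitz
    (Recurrent-cong (λ n → sym (*-cancelʳ-⁻¹ (solution n) (Π-nonzero n))) solution-recurrent)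

  CC-formula : ∀ cc → IsCC N cc → ∀ n → 1 ≤ n → cc n ≈ rhs N n
  CC-formula cc isCC (suc n) _ = begin
    cc (suc n)                    ≈⟨ ⁻¹-cancelʳ (cc (suc n)) (Π-nonzero (suc n)) ⟨
    (cc /Π) (suc n) * Π (suc n)   ≈⟨ *-congʳ (Recurrent-unique (IsCC⇒Recurrent cc isCC) solution-recurrent (suc n)) ⟩
    solution (suc n) * Π (suc n)  ≈⟨ *-comm _ _ ⟩
    Π (suc n) * solution (suc n)  ≈⟨ *-congˡ (solution-formula n) ⟩
    rhs N (suc n)                 ∎

theorem2 : ∀ {c ℓ : Level} (F : Field c ℓ) (p e r : ℕ) {{_ : NonZero r}}
    → Prime p → 1 ≤ e → r ≡ p ^ e
    → (T : Field.Carrier F)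
    → Field._≈_ F (Carlitz.natMul F r T p) (Field.0# F)
    → (∀ i → 1 ≤ i → ¬ (Field._≈_ F (Carlitz.br F r T i) (Field.0# F)))
    → (N : ℕ) → 1 ≤ N
    → Σ (ℕ → Field.Carrier F) (Carlitz.IsCC F r T N)
      × (∀ (cc : ℕ → Field.Carrier F) → Carlitz.IsCC F r T N cc
         → ∀ (n : ℕ) → 1 ≤ n → Field._≈_ F (cc n) (Carlitz.rhs F r T N n))
theorem2 F p e r p-prime 1≤e r≡p^e T _ br≉0 N _ = (cauchyCarlitz , cauchyCarlitz-isCC) , CC-formula
  where
  open CauchyCarlitz F r T (≡.subst (1 <_) (≡.sym r≡p^e) (1<prime^e p-prime 1≤e)) br≉0 N
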